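{- A family of structures $\mathfrak{K}$ is $E_{range}$-learnable if and only if $\mathfrak{K}$ is a $\Sigma^{\mathrm{inf}}_1$-partial order, i.e., $\mathrm{Th}_{\Sigma^{\mathrm{inf}}_1}(\mathcal{A})\neq\mathrm{Th}_{\Sigma^{\mathrm{inf}}_1}(\mathcal{B})$ for all distinct $\mathcal{A},\mathcal{B}\in\mathfrak{K}$.
   Context: All structures are countable, have domain $\mathbb{N}$, and are in a finite relational signature; a structure is identified with its atomic diagram in $2^{\mathbb{N}}$, so sets of structures carry the subspace topology of Cantor space. A family of structures $\mathfrak{K}$ is a countable set of pairwise nonisomorphic countable structures; $\mathrm{LD}(\mathfrak{K})$ is the set of all structures (with domain $\mathbb{N}$) isomorphic to a member of $\mathfrak{K}$. For an equivalence relation $E$ on a space $X$, $\mathfrak{K}$ is $E$-learnable if there is a continuous $\Gamma:\mathrm{LD}(\mathfrak{K})\to X$ such that for all $\mathcal{S},\mathcal{S}'\in\mathrm{LD}(\mathfrak{K})$: $\mathcal{S}\cong\mathcal{S}'$ iff $\Gamma(\mathcal{S})\,E\,\Gamma(\mathcal{S}')$. $E_{range}$ is the equivalence relation on Baire space $\mathbb{N}^{\mathbb{N}}$ given by $p\,E_{range}\,q$ iff $\{p(m):m\in\mathbb{N}\}=\{q(m):m\in\mathbb{N}\}$. $\Sigma^{\mathrm{inf}}_1$ formulas of $\mathcal{L}_{\omega_1\omega}$ are countable disjunctions of formulas $\exists\bar y\,\psi$ with $\psi$ finitary quantifier-free; $\mathrm{Th}_{\Sigma^{\mathrm{inf}}_1}(\mathcal{A})$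 is the set of closed $\Sigma^{\mathrm{inf}}_1$ formulas true in $\mathcal{A}$. -}

module Defs where

open import Level using (0ℓ)
open import Data.Nat using (ℕ; _<_; _≡ᵇ_)
open import Data.Fin using (Fin)
open import Data.Bool using (Bool; true; false; not; _∧_; _∨_)
open import Data.Vec using (Vec; map)
open import Data.Vec.Relation.Unary.All using (All)
open import Data.Product using (Σ; ∃; ∃-syntax; _×_; _,_)
open import Data.Sum using (_⊎_)
open import Function.Bundles using (_↔_; Inverse)
open import Relation.Binary.PropositionalEquality using (_≡_; _≢_)
open import Relation.Nullary using (¬_)

record Signature : Set where
  field
    nRel  : ℕ
    arity : Fin nRel → ℕ
open Signature public

-- Countable structures with domain ℕ, given by their atomic diagram:
-- for each relation symbol and each tuple, the truth value.

Structure : Signature → Set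
Structure L = (i : Fin (nRel L)) → Vec ℕ (arity L i) → Bool

_≅_ : {L : Signature} → Structure L → Structure L → Set
_≅_ {L} A B = Σ (ℕ ↔ ℕ) λ f →
  (i : Fin (nRel L)) (v : Vec ℕ (arity L i)) →
    A i v ≡ B i (map (Inverse.to f) v)

-- Families: a countable set (index type with an injection into ℕ) of
-- pairwise nonisomorphic structures.

record Family (L : Signature) : Set₁ where
  field
    Index  : Set
    code   : Index → ℕ
    code-injective : ∀ {i j} → code i ≡ code j → i ≡ j
    str    : Index → Structure L
    pairwise-noniso : ∀ i j → i ≢ j → ¬ (str i ≅ str j)
open Family public

InLD : {L : Signature} → Family L → Structure L → Set
InLD K S = ∃[ i ] (S ≅ str K i)

Baire : Set
Baire = ℕ → ℕ

AgreeBelow : {L : Signature} → ℕ → Structure L → Structure L → Set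
AgreeBelow {L} m S S' =
  (i : Fin (nRel L)) (v : Vec ℕ (arity L i)) → All (_< m) v → S i v ≡ S' i v

-- Continuity of Γ on LD(K) (w.r.t. the subspace topology of Cantor space):
-- every finite initial segment of the output is determined by a finite
-- part of the atomic diagram of the input, among inputs in LD(K).
ContinuousOn : {L : Signature} → Family L → (Structure L → Baire) → Set
ContinuousOn K Γ =
  ∀ S → InLD K S → ∀ n → ∃[ m ] (∀ S' → InLD K S' → AgreeBelow m S S' →
    ∀ k → k < n → Γ S k ≡ Γ S' k)

Erange : Baire → Baire → Set
Erange p q = (∀ m → ∃[ m' ] p m ≡ q m') × (∀ m → ∃[ m' ] q m ≡ p m')

ErangeLearnable : {L : Signature} → Family L → Set
ErangeLearnable K = ∃[ Γ ] (ContinuousOn K Γ ×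
  (∀ S S' → InLD K S → InLD K S' → (S ≅ S' → Erange (Γ S) (Γ S')) ×
                                   (Erange (Γ S) (Γ S') → S ≅ S')))

-- Σ^inf_1 sentences: countable disjunctions of ∃ȳ ψ, ψ finitary
-- quantifier-free (in variables ȳ).

data QF (L : Signature) (n : ℕ) : Set where
  rel  : (i : Fin (nRel L)) → Vec (Fin n) (arity L i) → QF L n
  eq   : Fin n → Fin n → QF L n
  tt ff : QF L n
  neg  : QF L n → QF L n
  and or : QF L n → QF L n → QF L n

evalQF : {L : Signature} {n : ℕ} → Structure L → QF L n → (Fin n → ℕ) → Bool
evalQF S (rel i xs) a = S i (map a xs)
evalQF S (eq x y)   a = a x ≡ᵇ a y
evalQF S tt         a = true
evalQF S ff         a = false
evalQF S (neg φ)    a = not (evalQF S φ a)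
evalQF S (and φ ψ)  a = evalQF S φ a ∧ evalQF S ψ a
evalQF S (or φ ψ)   a = evalQF S φ a ∨ evalQF S ψ a

record ExSentence (L : Signature) : Set where
  constructor ∃∃
  field
    nvars : ℕ
    body  : QF L nvars

Σ1inf : Signature → Set
Σ1inf L = ℕ → ExSentence L

_⊨∃_ : {L : Signature} → Structure L → ExSentence L → Set
S ⊨∃ ∃∃ n ψ = ∃[ a ] (evalQF S ψ a ≡ true)

_⊨_ : {L : Signature} → Structure L → Σ1inf L → Set
S ⊨ φ = ∃[ k ] (S ⊨∃ φ k)

SameΣ1Theory : {L : Signature} → Structure L → Structure L → Set
SameΣ1Theory A B = ∀ φ → (A ⊨ φ → B ⊨ φ) × (B ⊨ φ → A ⊨ φ)

Σ1PartialOrder : {L : Signature} → Family L → Set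
Σ1PartialOrder K = ∀ i j → i ≢ j → ¬ SameΣ1Theory (str K i) (str K j)

-- Both directions turn on one learner: Γ S lists, for every finite tuple of S, a code of the
-- tuple's length together with its atomic type. Isomorphic structures realise the same atomic
-- types, so the ranges agree; conversely the range of Γ S determines which existential
-- sentences S satisfies, i.e. its Σ^inf_1 theory. Hence Γ learns every Σ^inf_1-partial order.
-- For the other direction, if A and B have the same Σ^inf_1 theory then the existential
-- closure of the atomic diagram of A on {0,…,m-1} holds in B, which yields a copy of B
-- agreeing with A on {0,…,m-1}. Continuity of a learner at A then puts every value of Γ A into
-- the range of Γ B, so a learner cannot separate A from B.
module Submission where

open import Level using (0ℓ)
open import Axiom.ExcludedMiddle using (ExcludedMiddle)
open import Defs
open import Data.Bool using (Bool; true; false; T; not; _∧_; _∨_)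
open import Data.Empty using (⊥-elim)
open import Data.Fin using (Fin; toℕ; fromℕ<)
import Data.Fin as Fin
open import Data.Fin.Properties using (toℕ-injective; toℕ<n; fromℕ<-toℕ; toℕ-fromℕ<)
open import Data.List using (List; []; _∷_; _++_; length; replicate; concatMap; cartesianProductWith; allFin)
  renaming (map to mapL)
open import Data.List.Properties using (∷-injective) renaming (map-cong to mapL-cong)
open import Data.List.Membership.Propositional using (_∈_; lose)
open import Data.List.Membership.Propositional.Properties
  using (∈-allFin; ∈-map⁺; ∈-++⁺ˡ; ∈-++⁺ʳ; ∈-concatMap⁺; ∈-cartesianProductWith⁺)
open import Data.List.Relation.Unary.Any using (here; there)
open import Data.Nat using (ℕ; zero; suc; _+_; _<_; _≤_; _≡ᵇ_; _≟_; _<?_; s≤s)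
open import Data.Nat.Properties
  using ( ≤-refl; ≤-reflexive; ≤-trans; ≤-<-trans; m≤m+n; m≤n+m; n≤1+n; m≤n*m; +-suc; +-identityʳ
        ; n<1+n; m<n⇒m<1+n; <⇒≢; m<1+n⇒m<n∨m≡n; ≡ᵇ⇒≡; ≡⇒≡ᵇ)
open import Data.Nat.Binary as ℕᵇ using (ℕᵇ; 2[1+_]; 1+[2_])
open import Data.Nat.Binary.Properties using (toℕ-fromℕ; fromℕ-toℕ)
open import Data.Product using (Σ; ∃-syntax; _×_; _,_; proj₁; proj₂)
open import Data.Sum using (inj₁; inj₂)
open import Data.Vec using (Vec; []; _∷_; lookup; tabulate) renaming (map to mapV)
open import Data.Vec.Properties using (map-∘; map-cong; map-id; lookup-map; lookup∘tabulate)
open import Data.Vec.Relation.Unary.All using (All; []; _∷_)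
import Data.Vec.Relation.Unary.All as All
import Data.Vec.Relation.Unary.All.Properties as All
open import Function using (_∘_; Injective)
open import Function.Bundles using (_↔_; Inverse; Injection; mk↔ₛ′)
open import Function.Properties.Inverse using (↔-refl; ↔-sym; ↔-trans; ↔⇒↣)
open import Relation.Binary.PropositionalEquality
open import Relation.Nullary using (¬_; yes; no)
open import Relation.Nullary.Decidable using (dec-true; dec-false; decidable-stable)

open Inverse using (to; from; strictlyInverseˡ)
open ≡-Reasoning

module _ {L : Signature} where

  ≅-refl : {S : Structure L} → S ≅ S
  ≅-refl {S} = ↔-refl , λ i v → cong (S i) (sym (map-id v))

  ≅-sym : {S T : Structure L} → S ≅ T → T ≅ S
  ≅-sym {S} {T} (f , h) = ↔-sym f , λ i v → sym (begin
    S i (mapV (from f) v)               ≡⟨ h i (mapV (from f) v) ⟩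
    T i (mapV (to f) (mapV (from f) v)) ≡⟨ cong (T i) (sym (map-∘ (to f) (from f) v)) ⟩
    T i (mapV (to f ∘ from f) v)        ≡⟨ cong (T i) (map-cong (strictlyInverseˡ f) v) ⟩
    T i (mapV (λ x → x) v)              ≡⟨ cong (T i) (map-id v) ⟩
    T i v                               ∎)

  ≅-trans : {S T U : Structure L} → S ≅ T → T ≅ U → S ≅ U
  ≅-trans {S} {T} {U} (f , h) (g , k) = ↔-trans f g , λ i v → begin
    S i v                               ≡⟨ h i v ⟩
    T i (mapV (to f) v)                 ≡⟨ k i (mapV (to f) v) ⟩
    U i (mapV (to g) (mapV (to f) v))   ≡⟨ cong (U i) (sym (map-∘ (to g) (to f) v)) ⟩
    U i (mapV (to g ∘ to f) v)          ∎

  pullback : Structure L → ℕ ↔ ℕ → Structure L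
  pullback B π i v = B i (mapV (to π) v)

  pullback-≅ : (B : Structure L) (π : ℕ ↔ ℕ) → pullback B π ≅ B
  pullback-≅ B π = π , λ i v → refl

≡ᵇ-injective : {g : ℕ → ℕ} → Injective _≡_ _≡_ g → ∀ u w → (u ≡ᵇ w) ≡ (g u ≡ᵇ g w)
≡ᵇ-injective {g} g-inj u w with u ≟ w
... | yes refl = trans (dec-true (u ≟ u) refl) (sym (dec-true (g u ≟ g u) refl))
... | no u≢w   = trans (dec-false (u ≟ w) u≢w) (sym (dec-false (g u ≟ g w) (u≢w ∘ g-inj)))

module _ {L : Signature} {n : ℕ} where

  data Atomic : QF L n → Set where
    rel : ∀ i xs → Atomic (rel i xs)
    eq  : ∀ x y → Atomic (eq x y)

  evalQF-≡-atomic : {S S' : Structure L} {a b : Fin n → ℕ} →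
    (∀ {ψ} → Atomic ψ → evalQF S ψ a ≡ evalQF S' ψ b) → ∀ ψ → evalQF S ψ a ≡ evalQF S' ψ b
  evalQF-≡-atomic h (rel i xs) = h (rel i xs)
  evalQF-≡-atomic h (eq x y)   = h (eq x y)
  evalQF-≡-atomic h tt         = refl
  evalQF-≡-atomic h ff         = refl
  evalQF-≡-atomic h (neg ψ)    = cong not (evalQF-≡-atomic h ψ)
  evalQF-≡-atomic h (and ψ χ)  = cong₂ _∧_ (evalQF-≡-atomic h ψ) (evalQF-≡-atomic h χ)
  evalQF-≡-atomic h (or ψ χ)   = cong₂ _∨_ (evalQF-≡-atomic h ψ) (evalQF-≡-atomic h χ)

  evalQF-≗ : (S : Structure L) {a b : Fin n → ℕ} → (∀ x → a x ≡ b x) →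
    ∀ ψ → evalQF S ψ a ≡ evalQF S ψ b
  evalQF-≗ S a≗b = evalQF-≡-atomic λ where
    (rel i xs) → cong (S i) (map-cong a≗b xs)
    (eq x y)   → cong₂ _≡ᵇ_ (a≗b x) (a≗b y)

  evalQF-≅ : {S S' : Structure L} ((f , _) : S ≅ S') (a : Fin n → ℕ) →
    ∀ ψ → evalQF S ψ a ≡ evalQF S' ψ (to f ∘ a)
  evalQF-≅ {S' = S'} (f , h) a = evalQF-≡-atomic λ where
    (rel i xs) → trans (h i (mapV a xs)) (cong (S' i) (sym (map-∘ (to f) a xs)))
    (eq x y)   → ≡ᵇ-injective (Injection.injective (↔⇒↣ f)) (a x) (a y)

  evalQF-AgreeBelow : {S S' : Structure L} {m : ℕ} → AgreeBelow m S S' →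
    (a : Fin n → ℕ) → (∀ x → a x < m) → ∀ ψ → evalQF S ψ a ≡ evalQF S' ψ a
  evalQF-AgreeBelow agree a a<m = evalQF-≡-atomic λ where
    (rel i xs) → agree i (mapV a xs) (All.map⁺ (All.universal a<m xs))
    (eq x y)   → refl

vectors : (n k : ℕ) → List (Vec (Fin n) k)
vectors n zero    = [] ∷ []
vectors n (suc k) = cartesianProductWith _∷_ (allFin n) (vectors n k)

∈-vectors : {n k : ℕ} (v : Vec (Fin n) k) → v ∈ vectors n k
∈-vectors []      = here refl
∈-vectors (x ∷ v) = ∈-cartesianProductWith⁺ _∷_ (∈-allFin x) (∈-vectors v)

relationAtoms : (L : Signature) (n : ℕ) → Fin (nRel L) → List (QF L n)
relationAtoms L n i = mapL (rel i) (vectors n (arity L i))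

atoms : (L : Signature) (n : ℕ) → List (QF L n)
atoms L n = concatMap (relationAtoms L n) (allFin (nRel L))
         ++ cartesianProductWith eq (allFin n) (allFin n)

∈-atoms : {L : Signature} {n : ℕ} {ψ : QF L n} → Atomic ψ → ψ ∈ atoms L n
∈-atoms {L} {n} (rel i xs) =
  ∈-++⁺ˡ (∈-concatMap⁺ (relationAtoms L n) (lose (∈-allFin i) (∈-map⁺ (rel i) (∈-vectors xs))))
∈-atoms {L} {n} (eq x y) =
  ∈-++⁺ʳ (concatMap (relationAtoms L n) (allFin (nRel L)))
         (∈-cartesianProductWith⁺ eq (∈-allFin x) (∈-allFin y))

mapL-≡-∈ : {A B : Set} {f g : A → B} {x : A} (xs : List A) → mapL f xs ≡ mapL g xs → x ∈ xs → f x ≡ g x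
mapL-≡-∈ (y ∷ ys) fxs≡gxs (here refl) = proj₁ (∷-injective fxs≡gxs)
mapL-≡-∈ (y ∷ ys) fxs≡gxs (there x∈ys) = mapL-≡-∈ ys (proj₂ (∷-injective fxs≡gxs)) x∈ys

-- ℕᵇ is bijective base 2: the digits 1+[2_] and 2[1+_] are read as false and true.
digits : ℕᵇ → List Bool
digits ℕᵇ.zero  = []
digits 2[1+ x ] = true ∷ digits x
digits 1+[2 x ] = false ∷ digits x

fromDigits : List Bool → ℕᵇ
fromDigits []          = ℕᵇ.zero
fromDigits (true ∷ w)  = 2[1+ fromDigits w ]
fromDigits (false ∷ w) = 1+[2 fromDigits w ]

digits-fromDigits : ∀ w → digits (fromDigits w) ≡ w
digits-fromDigits []          = refl
digits-fromDigits (true ∷ w)  = cong (true ∷_) (digits-fromDigits w)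
digits-fromDigits (false ∷ w) = cong (false ∷_) (digits-fromDigits w)

length-digits≤toℕ : ∀ x → length (digits x) ≤ ℕᵇ.toℕ x
length-digits≤toℕ ℕᵇ.zero  = ≤-refl
length-digits≤toℕ 2[1+ x ] = ≤-trans (s≤s (length-digits≤toℕ x)) (m≤n*m (suc (ℕᵇ.toℕ x)) 2)
length-digits≤toℕ 1+[2 x ] = s≤s (≤-trans (length-digits≤toℕ x) (m≤n*m (ℕᵇ.toℕ x) 2))

⌜_⌝ : List Bool → ℕ
⌜ w ⌝ = ℕᵇ.toℕ (fromDigits w)

word : ℕ → List Bool
word k = digits (ℕᵇ.fromℕ k)

word-⌜⌝ : ∀ w → word ⌜ w ⌝ ≡ w
word-⌜⌝ w = trans (cong digits (fromℕ-toℕ (fromDigits w))) (digits-fromDigits w)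

length-word : ∀ k → length (word k) ≤ k
length-word k = subst (length (word k) ≤_) (toℕ-fromℕ k) (length-digits≤toℕ (ℕᵇ.fromℕ k))

⌜⌝-injective : ∀ {w w'} → ⌜ w ⌝ ≡ ⌜ w' ⌝ → w ≡ w'
⌜⌝-injective {w} {w'} ⌜w⌝≡⌜w'⌝ = begin
  w            ≡⟨ word-⌜⌝ w ⟨
  word ⌜ w ⌝   ≡⟨ cong word ⌜w⌝≡⌜w'⌝ ⟩
  word ⌜ w' ⌝  ≡⟨ word-⌜⌝ w' ⟩
  w'           ∎

_▸_ : ℕ → List Bool → List Bool
x ▸ w = replicate x true ++ false ∷ w

▸-injective : ∀ x x' w w' → x ▸ w ≡ x' ▸ w' → x ≡ x' × w ≡ w'
▸-injective zero    zero     w w' x▸w≡x'▸w' = refl , proj₂ (∷-injective x▸w≡x'▸w')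
▸-injective (suc x) (suc x') w w' x▸w≡x'▸w'
  with ▸-injective x x' w w' (proj₂ (∷-injective x▸w≡x'▸w'))
... | refl , w≡w' = refl , w≡w'

Tuple : Set
Tuple = Σ ℕ (Vec ℕ)

_∷ᵗ_ : ℕ → Tuple → Tuple
x ∷ᵗ t = suc (proj₁ t) , x ∷ proj₂ t

unary : {n : ℕ} → Vec ℕ n → List Bool
unary []      = []
unary (x ∷ v) = x ▸ unary v

-- `acc` counts the digits true read so far of the current entry.
readTuple : ℕ → List Bool → Tuple
readTuple acc []          = 0 , []
readTuple acc (true ∷ w)  = readTuple (suc acc) w
readTuple acc (false ∷ w) = acc ∷ᵗ readTuple 0 w

readTuple-replicate : ∀ x acc w → readTuple acc (replicate x true ++ w) ≡ readTuple (x + acc) w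
readTuple-replicate zero    acc w = refl
readTuple-replicate (suc x) acc w = trans (readTuple-replicate x (suc acc) w) (cong (λ a → readTuple a w) (+-suc x acc))

readTuple-unary : {n : ℕ} (v : Vec ℕ n) → readTuple 0 (unary v) ≡ (n , v)
readTuple-unary []      = refl
readTuple-unary (x ∷ v) = begin
  readTuple 0 (x ▸ unary v)             ≡⟨ readTuple-replicate x 0 (false ∷ unary v) ⟩
  (x + 0) ∷ᵗ readTuple 0 (unary v)      ≡⟨ cong₂ _∷ᵗ_ (+-identityʳ x) (readTuple-unary v) ⟩
  x ∷ᵗ (_ , v)                          ∎

readTuple-bounded : ∀ acc w i → lookup (proj₂ (readTuple acc w)) i ≤ acc + length w
readTuple-bounded acc (true ∷ w)  i =
  ≤-trans (readTuple-bounded (suc acc) w i) (≤-reflexive (sym (+-suc acc (length w))))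
readTuple-bounded acc (false ∷ w) Fin.zero    = m≤m+n acc (suc (length w))
readTuple-bounded acc (false ∷ w) (Fin.suc i) =
  ≤-trans (readTuple-bounded 0 w i) (≤-trans (n≤1+n (length w)) (m≤n+m (suc (length w)) acc))

tuple : ℕ → Tuple
tuple k = readTuple 0 (word k)

tuple-⌜unary⌝ : {n : ℕ} (v : Vec ℕ n) → tuple ⌜ unary v ⌝ ≡ (n , v)
tuple-⌜unary⌝ v = trans (cong (readTuple 0) (word-⌜⌝ (unary v))) (readTuple-unary v)

tuple-bounded : ∀ k i → lookup (proj₂ (tuple k)) i ≤ k
tuple-bounded k i = ≤-trans (readTuple-bounded 0 (word k) i) (length-word k)

RangeSubset : Baire → Baire → Set
RangeSubset p q = ∀ m → ∃[ m' ] p m ≡ q m'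

RangeSubset-trans : {p q r : Baire} → RangeSubset p q → RangeSubset q r → RangeSubset p r
RangeSubset-trans p⊆q q⊆r m with p⊆q m
... | m' , pm≡qm' with q⊆r m'
... | m'' , qm'≡rm'' = m'' , trans pm≡qm' qm'≡rm''

module _ {L : Signature} where

  atomicType : {n : ℕ} → Structure L → (Fin n → ℕ) → List Bool
  atomicType {n} S a = mapL (λ ψ → evalQF S ψ a) (atoms L n)

  typeCode : Structure L → Tuple → ℕ
  typeCode S (n , v) = ⌜ n ▸ atomicType S (lookup v) ⌝

  Γ : Structure L → Baire
  Γ S = typeCode S ∘ tuple

  -- The entries of tuple k are at most k, so Γ S restricted to {0,…,N-1} only reads the
  -- diagram of S on {0,…,N-1}.
  Γ-continuous : (K : Family L) → ContinuousOn K Γ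
  Γ-continuous K S _ N = N , λ S' _ agree k k<N →
    let (n , v) = tuple k in
    cong (λ w → ⌜ n ▸ w ⌝)
      (mapL-cong (evalQF-AgreeBelow agree (lookup v) (λ i → ≤-<-trans (tuple-bounded k i) k<N)) (atoms L n))

  typeCode-≅ : {S S' : Structure L} (iso : S ≅ S') {n : ℕ} (v : Vec ℕ n) →
    typeCode S (n , v) ≡ typeCode S' (n , mapV (to (proj₁ iso)) v)
  typeCode-≅ {S} {S'} iso@(f , _) {n} v = cong (λ w → ⌜ n ▸ w ⌝) (mapL-cong (λ ψ → begin
    evalQF S ψ (lookup v)                   ≡⟨ evalQF-≅ iso (lookup v) ψ ⟩
    evalQF S' ψ (to f ∘ lookup v)           ≡⟨ evalQF-≗ S' (λ x → sym (lookup-map x (to f) v)) ψ ⟩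
    evalQF S' ψ (lookup (mapV (to f) v))    ∎) (atoms L n))

  Γ-≅ : {S S' : Structure L} → S ≅ S' → RangeSubset (Γ S) (Γ S')
  Γ-≅ {S} {S'} iso@(f , _) k = ⌜ unary (mapV (to f) v) ⌝ , (begin
    typeCode S (n , v)                      ≡⟨ typeCode-≅ iso v ⟩
    typeCode S' (n , mapV (to f) v)         ≡⟨ cong (typeCode S') (tuple-⌜unary⌝ (mapV (to f) v)) ⟨
    Γ S' ⌜ unary (mapV (to f) v) ⌝          ∎)
    where
    n : ℕ
    n = proj₁ (tuple k)
    v : Vec ℕ n
    v = proj₂ (tuple k)

  Γ-invariant : {S S' : Structure L} → S ≅ S' → Erange (Γ S) (Γ S')
  Γ-invariant iso = Γ-≅ iso , Γ-≅ (≅-sym iso)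

  Erange-transport : {S S' T T' : Structure L} → S ≅ T → S' ≅ T' → Erange (Γ S) (Γ S') → Erange (Γ T) (Γ T')
  Erange-transport S≅T S'≅T' (S⊆S' , S'⊆S) =
      RangeSubset-trans (Γ-≅ (≅-sym S≅T)) (RangeSubset-trans S⊆S' (Γ-≅ S'≅T'))
    , RangeSubset-trans (Γ-≅ (≅-sym S'≅T')) (RangeSubset-trans S'⊆S (Γ-≅ S≅T))

  typeCode-⊨∃ : {S S' : Structure L} {n : ℕ} (v : Vec ℕ n) (t : Tuple) → typeCode S (n , v) ≡ typeCode S' t →
    (ψ : QF L n) → evalQF S ψ (lookup v) ≡ true → S' ⊨∃ ∃∃ n ψ
  typeCode-⊨∃ {S} {S'} {n} v (n' , w) codes≡ ψ S⊨ψ with ▸-injective n n' _ _ (⌜⌝-injective codes≡)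
  ... | refl , types≡ = lookup w , (begin
    evalQF S' ψ (lookup w)   ≡⟨ evalQF-≡-atomic (λ at → mapL-≡-∈ (atoms L n) types≡ (∈-atoms at)) ψ ⟨
    evalQF S ψ (lookup v)    ≡⟨ S⊨ψ ⟩
    true                     ∎)

  ⊨∃-RangeSubset : {S S' : Structure L} → RangeSubset (Γ S) (Γ S') → (e : ExSentence L) → S ⊨∃ e → S' ⊨∃ e
  ⊨∃-RangeSubset {S} {S'} S⊆S' (∃∃ n ψ) (a , S⊨ψ) with S⊆S' ⌜ unary (tabulate a) ⌝
  ... | k' , codes≡ = typeCode-⊨∃ (tabulate a) (tuple k')
    (trans (cong (typeCode S) (sym (tuple-⌜unary⌝ (tabulate a)))) codes≡) ψ
    (trans (evalQF-≗ S (lookup∘tabulate a) ψ) S⊨ψ)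

  Erange⇒SameΣ1Theory : {S S' : Structure L} → Erange (Γ S) (Γ S') → SameΣ1Theory S S'
  Erange⇒SameΣ1Theory (S⊆S' , S'⊆S) φ = (λ (k , S⊨φₖ) → k , ⊨∃-RangeSubset S⊆S' (φ k) S⊨φₖ)
                                      , (λ (k , S'⊨φₖ) → k , ⊨∃-RangeSubset S'⊆S (φ k) S'⊨φₖ)

index-≡-stable : {L : Signature} (K : Family L) {i j : Index K} → ¬ ¬ i ≡ j → i ≡ j
index-≡-stable K {i} {j} ¬¬i≡j = code-injective K
  (decidable-stable (code K i ≟ code K j) (λ codes≢ → ¬¬i≡j (codes≢ ∘ cong (code K))))

module _ {L : Signature} (K : Family L) where

  Erange⇒index-≡ : Σ1PartialOrder K → ∀ {i j} → Erange (Γ (str K i)) (Γ (str K j)) → i ≡ j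
  Erange⇒index-≡ po {i} {j} Aᵢ~Aⱼ = index-≡-stable K (λ i≢j → po i j i≢j (Erange⇒SameΣ1Theory Aᵢ~Aⱼ))

  Σ1PartialOrder⇒ErangeLearnable : Σ1PartialOrder K → ErangeLearnable K
  Σ1PartialOrder⇒ErangeLearnable po = Γ , Γ-continuous K , λ S S' S∈ S'∈ → Γ-invariant , Γ-reflects S∈ S'∈
    where
    Γ-reflects : ∀ {S S'} → InLD K S → InLD K S' → Erange (Γ S) (Γ S') → S ≅ S'
    Γ-reflects {S} {S'} (i , S≅Aᵢ) (j , S'≅Aⱼ) S~S' =
      ≅-trans {U = S'} S≅Aᵢ (subst (λ k → str K k ≅ S') (sym i≡j) (≅-sym S'≅Aⱼ))
      where
      i≡j : i ≡ j
      i≡j = Erange⇒index-≡ po (Erange-transport S≅Aᵢ S'≅Aⱼ S~S')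

swap : ℕ → ℕ → ℕ → ℕ
swap p q x with x ≟ p
... | yes _ = q
... | no _ with x ≟ q
...   | yes _ = p
...   | no _  = x

swap-p : ∀ p q → swap p q p ≡ q
swap-p p q with p ≟ p
... | yes _  = refl
... | no p≢p = ⊥-elim (p≢p refl)

swap-q : ∀ p q → swap p q q ≡ p
swap-q p q with q ≟ p
... | yes q≡p = q≡p
... | no _ with q ≟ q
...   | yes _  = refl
...   | no q≢q = ⊥-elim (q≢q refl)

swap-other : ∀ p q x → x ≢ p → x ≢ q → swap p q x ≡ x
swap-other p q x x≢p x≢q with x ≟ p
... | yes x≡p = ⊥-elim (x≢p x≡p)
... | no _ with x ≟ q
...   | yes x≡q = ⊥-elim (x≢q x≡q)
...   | no _    = refl

swap-involutive : ∀ p q x → swap p q (swap p q x) ≡ x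
swap-involutive p q x with x ≟ p
... | yes refl = swap-q x q
... | no x≢p with x ≟ q
...   | yes refl = swap-p p x
...   | no x≢q   = swap-other p q x x≢p x≢q

transposition : ℕ → ℕ → ℕ ↔ ℕ
transposition p q = mk↔ₛ′ (swap p q) (swap p q) (swap-involutive p q) (swap-involutive p q)

-- The permutation for m + 1 points is the one for m points preceded by the transposition of m
-- with the preimage of b m, which lies outside {0,…,m-1} by injectivity.
extend-injection : (m : ℕ) (b : ℕ → ℕ) → (∀ {x y} → x < m → y < m → b x ≡ b y → x ≡ y) →
  Σ (ℕ ↔ ℕ) λ π → ∀ {x} → x < m → to π x ≡ b x
extend-injection zero    b b-inj = ↔-refl , λ ()
extend-injection (suc m) b b-inj with extend-injection m b (λ x<m y<m → b-inj (m<n⇒m<1+n x<m) (m<n⇒m<1+n y<m))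
... | π , π≡b = ↔-trans (transposition m y) π , π'≡b
  where
  y : ℕ
  y = from π (b m)
  πy≡bm : to π y ≡ b m
  πy≡bm = strictlyInverseˡ π (b m)
  y∉m : ∀ {x} → x < m → x ≢ y
  y∉m x<m refl = <⇒≢ x<m (b-inj (m<n⇒m<1+n x<m) (n<1+n m) (trans (sym (π≡b x<m)) πy≡bm))
  π'≡b : ∀ {x} → x < suc m → to π (swap m y x) ≡ b x
  π'≡b {x} x<1+m with m<1+n⇒m<n∨m≡n x<1+m
  ... | inj₁ x<m  = trans (cong (to π) (swap-other m y x (<⇒≢ x<m) (y∉m x<m))) (π≡b x<m)
  ... | inj₂ refl = trans (cong (to π) (swap-p x y)) πy≡bm

onℕ : (m : ℕ) → (Fin m → ℕ) → ℕ → ℕ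
onℕ m b x with x <? m
... | yes x<m = b (fromℕ< x<m)
... | no _    = 0

onℕ-toℕ : (m : ℕ) (b : Fin m → ℕ) (x : Fin m) → onℕ m b (toℕ x) ≡ b x
onℕ-toℕ m b x with toℕ x <? m
... | yes x<m = cong b (fromℕ<-toℕ x x<m)
... | no x≮m  = ⊥-elim (x≮m (toℕ<n x))

toFins : {k m : ℕ} (v : Vec ℕ k) → All (_< m) v → Vec (Fin m) k
toFins []      []            = []
toFins (x ∷ v) (x<m ∷ v<m)   = fromℕ< x<m ∷ toFins v v<m

map-toℕ-toFins : {k m : ℕ} (v : Vec ℕ k) (v<m : All (_< m) v) → mapV toℕ (toFins v v<m) ≡ v
map-toℕ-toFins []      []          = refl
map-toℕ-toFins (x ∷ v) (x<m ∷ v<m) = cong₂ _∷_ (toℕ-fromℕ< x<m) (map-toℕ-toFins v v<m)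

module _ {L : Signature} where

  literal : {n : ℕ} → Bool → QF L n → QF L n
  literal true  ψ = ψ
  literal false ψ = neg ψ

  literal-true : {n : ℕ} (S : Structure L) (a : Fin n → ℕ) (c : Bool) (ψ : QF L n) →
    evalQF S (literal c ψ) a ≡ true → evalQF S ψ a ≡ c
  literal-true S a true  ψ S⊨ψ = S⊨ψ
  literal-true S a false ψ S⊨¬ψ with evalQF S ψ a
  ... | false = refl

  literal-holds : {n : ℕ} (S : Structure L) (a : Fin n → ℕ) (ψ : QF L n) →
    evalQF S (literal (evalQF S ψ a) ψ) a ≡ true
  literal-holds S a ψ with evalQF S ψ a in S⊨ψ
  ... | true  = S⊨ψ
  ... | false = cong not S⊨ψ

  diagramOn : {m : ℕ} → Structure L → List (QF L m) → QF L m
  diagramOn A []       = tt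
  diagramOn A (ψ ∷ ψs) = and (literal (evalQF A ψ toℕ) ψ) (diagramOn A ψs)

  diagramOn-holds : {m : ℕ} (A : Structure L) (ψs : List (QF L m)) → evalQF A (diagramOn A ψs) toℕ ≡ true
  diagramOn-holds A []       = refl
  diagramOn-holds A (ψ ∷ ψs) = cong₂ _∧_ (literal-holds A toℕ ψ) (diagramOn-holds A ψs)

  diagramOn-sound : {m : ℕ} (A B : Structure L) (b : Fin m → ℕ) (ψs : List (QF L m)) →
    evalQF B (diagramOn A ψs) b ≡ true → ∀ {ψ} → ψ ∈ ψs → evalQF B ψ b ≡ evalQF A ψ toℕ
  diagramOn-sound A B b (ψ ∷ ψs) B⊨D (here refl) with evalQF B (literal (evalQF A ψ toℕ) ψ) b in B⊨lit
  ... | true = literal-true B b (evalQF A ψ toℕ) ψ B⊨lit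
  diagramOn-sound A B b (ψ ∷ ψs) B⊨D (there ψ∈ψs) with evalQF B (literal (evalQF A ψ toℕ) ψ) b
  ... | true = diagramOn-sound A B b ψs B⊨D ψ∈ψs

  SameΣ1Theory-sym : {A B : Structure L} → SameΣ1Theory A B → SameΣ1Theory B A
  SameΣ1Theory-sym same φ = proj₂ (same φ) , proj₁ (same φ)

  SameΣ1Theory⇒realises-diagram : {A B : Structure L} → SameΣ1Theory A B → (m : ℕ) →
    Σ (Fin m → ℕ) λ b → ∀ {ψ} → Atomic ψ → evalQF B ψ b ≡ evalQF A ψ toℕ
  SameΣ1Theory⇒realises-diagram {A} {B} same m
    with proj₁ (same (λ _ → ∃∃ m (diagramOn A (atoms L m)))) (0 , toℕ , diagramOn-holds A (atoms L m))
  ... | _ , b , B⊨D = b , λ at → diagramOn-sound A B b (atoms L m) B⊨D (∈-atoms at)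

  realisation⇒agreeing-copy : {A B : Structure L} {m : ℕ} (b : Fin m → ℕ) →
    (∀ {ψ} → Atomic ψ → evalQF B ψ b ≡ evalQF A ψ toℕ) →
    Σ (Structure L) λ B' → B' ≅ B × AgreeBelow m A B'
  realisation⇒agreeing-copy {A} {B} {m} b b-realises = pullback B π , pullback-≅ B π , agree
    where
    b-injective : Injective _≡_ _≡_ b
    b-injective {x} {y} bx≡by = toℕ-injective (≡ᵇ⇒≡ (toℕ x) (toℕ y)
      (subst T (b-realises (eq x y)) (≡⇒≡ᵇ (b x) (b y) bx≡by)))

    onℕ-fromℕ< : ∀ {x} (x<m : x < m) → onℕ m b x ≡ b (fromℕ< x<m)
    onℕ-fromℕ< x<m = subst (λ x → onℕ m b x ≡ b (fromℕ< x<m)) (toℕ-fromℕ< x<m) (onℕ-toℕ m b (fromℕ< x<m))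

    onℕ-injective : ∀ {x y} → x < m → y < m → onℕ m b x ≡ onℕ m b y → x ≡ y
    onℕ-injective {x} {y} x<m y<m b'x≡b'y = begin
      x                      ≡⟨ toℕ-fromℕ< x<m ⟨
      toℕ (fromℕ< x<m)       ≡⟨ cong toℕ (b-injective (trans (sym (onℕ-fromℕ< x<m)) (trans b'x≡b'y (onℕ-fromℕ< y<m)))) ⟩
      toℕ (fromℕ< y<m)       ≡⟨ toℕ-fromℕ< y<m ⟩
      y                      ∎

    π : ℕ ↔ ℕ
    π = proj₁ (extend-injection m (onℕ m b) onℕ-injective)

    π-toℕ : ∀ x → to π (toℕ x) ≡ b x
    π-toℕ x = trans (proj₂ (extend-injection m (onℕ m b) onℕ-injective) (toℕ<n x)) (onℕ-toℕ m b x)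

    agree : AgreeBelow m A (pullback B π)
    agree i v v<m = begin
      A i v                                 ≡⟨ cong (A i) (map-toℕ-toFins v v<m) ⟨
      A i (mapV toℕ xs)                     ≡⟨ b-realises (rel i xs) ⟨
      B i (mapV b xs)                       ≡⟨ cong (B i) (map-cong (sym ∘ π-toℕ) xs) ⟩
      B i (mapV (to π ∘ toℕ) xs)            ≡⟨ cong (B i) (map-∘ (to π) toℕ xs) ⟩
      B i (mapV (to π) (mapV toℕ xs))       ≡⟨ cong (B i ∘ mapV (to π)) (map-toℕ-toFins v v<m) ⟩
      B i (mapV (to π) v)                   ∎
      where
      xs : Vec (Fin m) _
      xs = toFins v v<m

  SameΣ1Theory⇒RangeSubset : (K : Family L) (G : Structure L → Baire) → ContinuousOn K G →
    (∀ S S' → InLD K S → InLD K S' → S ≅ S' → Erange (G S) (G S')) →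
    ∀ {A B} → InLD K A → InLD K B → SameΣ1Theory A B → RangeSubset (G A) (G B)
  SameΣ1Theory⇒RangeSubset K G G-continuous G-invariant {A} {B} A∈ (j , B≅Aⱼ) same m₀ =
    let (m , G-agrees)     = G-continuous A A∈ (suc m₀)
        (b , b-realises)   = SameΣ1Theory⇒realises-diagram same m
        (B' , B'≅B , A≈B') = realisation⇒agreeing-copy b b-realises
        B'∈                = j , ≅-trans {U = str K j} B'≅B B≅Aⱼ
        (m' , G⟨B'⟩≡G⟨B⟩)  = proj₁ (G-invariant B' B B'∈ (j , B≅Aⱼ) B'≅B) m₀
    in m' , trans (G-agrees B' B'∈ A≈B' m₀ (n<1+n m₀)) G⟨B'⟩≡G⟨B⟩

ErangeLearnable⇒Σ1PartialOrder : {L : Signature} (K : Family L) → ErangeLearnable K → Σ1PartialOrder K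
ErangeLearnable⇒Σ1PartialOrder K (G , G-continuous , G-learns) i j i≢j same =
  pairwise-noniso K i j i≢j (proj₂ (G-learns (str K i) (str K j) Aᵢ∈ Aⱼ∈)
    ( SameΣ1Theory⇒RangeSubset K G G-continuous G-invariant Aᵢ∈ Aⱼ∈ same
    , SameΣ1Theory⇒RangeSubset K G G-continuous G-invariant Aⱼ∈ Aᵢ∈ (SameΣ1Theory-sym same)))
  where
  Aᵢ∈ : InLD K (str K i)
  Aᵢ∈ = i , ≅-refl
  Aⱼ∈ : InLD K (str K j)
  Aⱼ∈ = j , ≅-refl
  G-invariant : ∀ S S' → InLD K S → InLD K S' → S ≅ S' → Erange (G S) (G S')
  G-invariant S S' S∈ S'∈ = proj₁ (G-learns S S' S∈ S'∈)

mainTheorem6 : ExcludedMiddle 0ℓ → (L : Signature) → (K : Family L) →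
    (ErangeLearnable K → Σ1PartialOrder K) × (Σ1PartialOrder K → ErangeLearnable K)
mainTheorem6 _ L K = ErangeLearnable⇒Σ1PartialOrder K , Σ1PartialOrder⇒ErangeLearnable K
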